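{- Let $k\leq n$ be positive integers and let $n_1,\dots,n_k\geq 0$ be integers with $n_1+\cdots+n_k\leq n$. Let $B_{n_1,\dots,n_k}$ be any $k\times n$ matrix with entries in $\{\pm1\}$ such that every column contains at most one entry equal to $-1$ and, for each $i$, the $i$-th row contains exactly $n_i$ entries equal to $-1$. Then $$\mathrm{per}(B_{n_1,\dots,n_k})=\sum_{\ell=0}^k\alpha_\ell(n)\,e_\ell(n_1,\dots,n_k),\qquad\text{where }\alpha_\ell(n)=(-2)^\ell (n-\ell)_{k-\ell}.$$
   Context: For a $k\times n$ matrix $A$ with $k\leq n$, $\mathrm{per}(A)=\sum_{\sigma}A_{1\sigma(1)}\cdots A_{k\sigma(k)}$, the sum ranging over all injective functions $\sigma:\{1,\dots,k\}\to\{1,\dots,n\}$. For integers $m$ and $j\geq0$, $(m)_j=m(m-1)\cdots(m-j+1)$ is the falling factorial (with $(m)_0=1$). $e_\ell(x_1,\dots,x_k)=\sum_{S\subseteq\{1,\dots,k\},|S|=\ell}\prod_{i\in S}x_i$ is the $\ell$-th elementary symmetric polynomial (with $e_0=1$). -}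

module Defs where

open import Data.Nat as ℕ using (ℕ; zero; suc)
open import Data.Integer as ℤ using (ℤ; +_; -[1+_])
open import Data.Fin using (Fin)
open import Data.Fin.Properties using (all?)
open import Data.List using (List; []; _∷_; map; concatMap; filter; allFin; length)
open import Data.Product using (_×_; _,_)
open import Relation.Nullary using (Dec; ¬_)
open import Relation.Nullary.Decidable using (¬?; _→-dec_)
open import Relation.Binary.PropositionalEquality using (_≡_; _≢_)
import Data.Fin.Properties as FinP
import Data.Integer.Properties as ℤP

allFuns : (k n : ℕ) → List (Fin k → Fin n)
allFuns zero    n = (λ ()) ∷ []
allFuns (suc k) n =
  concatMap (λ j → map (λ f → λ { Fin.zero → j ; (Fin.suc i) → f i }) (allFuns k n))
            (allFin n)

Inj : ∀ {k n} → (Fin k → Fin n) → Set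
Inj {k} f = (i j : Fin k) → f i ≡ f j → i ≡ j

inj? : ∀ {k n} (f : Fin k → Fin n) → Dec (Inj f)
inj? f = all? λ i → all? λ j → (f i FinP.≟ f j) →-dec (i FinP.≟ j)

injections : (k n : ℕ) → List (Fin k → Fin n)
injections k n = filter inj? (allFuns k n)

sumℤ : List ℤ → ℤ
sumℤ []       = + 0
sumℤ (x ∷ xs) = x ℤ.+ sumℤ xs

prodFin : ∀ k → (Fin k → ℤ) → ℤ
prodFin zero    g = + 1
prodFin (suc k) g = g Fin.zero ℤ.* prodFin k (λ i → g (Fin.suc i))

per : ∀ {k n} → (Fin k → Fin n → ℤ) → ℤ
per {k} {n} A = sumℤ (map (λ σ → prodFin k (λ i → A i (σ i))) (injections k n))

falling : ℕ → ℕ → ℕ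
falling m zero    = 1
falling m (suc j) = m ℕ.* falling (m ℕ.∸ 1) j

esym : ∀ k → ℕ → (Fin k → ℤ) → ℤ
esym k       zero    x = + 1
esym zero    (suc ℓ) x = + 0
esym (suc k) (suc ℓ) x =
  x Fin.zero ℤ.* esym k ℓ (λ i → x (Fin.suc i)) ℤ.+ esym k (suc ℓ) (λ i → x (Fin.suc i))

countNeg : ∀ {n} → (Fin n → ℤ) → ℕ
countNeg {n} r = length (filter (λ c → r c ℤP.≟ ℤ.-[1+ 0 ]) (allFin n))

sumUpTo : ℕ → (ℕ → ℤ) → ℤ
sumUpTo zero    f = f 0
sumUpTo (suc k) f = sumUpTo k f ℤ.+ f (suc k)

sumFinℕ : ∀ k → (Fin k → ℕ) → ℕ
sumFinℕ zero    x = 0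
sumFinℕ (suc k) x = x Fin.zero ℕ.+ sumFinℕ k (λ i → x (Fin.suc i))

-- Write B = J − 2N, where N is the 0/1 matrix of the entries −1: its columns have disjoint
-- supports and its row sums are nᵢ. Expanding the permanent along the first row and deleting the
-- chosen column shows that per(J − 2N) depends only on the number m of columns and the row sums a,
-- through a polynomial P with
--   P_{k+1}(m, a) = (m − k) P_k(m, a′) − 2 a₀ P_k(m − 1, a′),   a′ = (a₁, …, a_k).
-- Deleting column c lowers the row sum of the row holding its nonzero entry; since P_k is affine in
-- each aᵢ, summing over c produces the Euler operator ∑ᵢ aᵢ ∂ᵢ P_k, and the identity
-- m P_k(m − 1) − (∑ᵢ aᵢ ∂ᵢ P_k)(m − 1) = (m − k) P_k(m) closes the induction. The closed form
-- ∑_ℓ (−2)^ℓ (m − ℓ)_{k−ℓ} e_ℓ(a) satisfies the same recursion, by e_ℓ(a) = e_ℓ(a′) + a₀ e_{ℓ−1}(a′)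
-- and (m − ℓ)_{k+1−ℓ} = (m − k) (m − ℓ)_{k−ℓ}.

module Submission where

open import Defs
open import Data.Nat as ℕ using (ℕ; zero; suc; _≤_; _∸_; z≤n; s≤s)
import Data.Nat.Properties as ℕP
open import Data.Integer as ℤ using (ℤ; +_; -[1+_]; _+_; _*_; _-_; -_; _^_)
import Data.Integer.Properties as ℤP
open import Data.Integer.Tactic.RingSolver using (solve-∀)
open import Data.Fin using (Fin; zero; suc; punchIn)
import Data.Fin.Properties as FinP
open import Data.Fin.Properties using () renaming (_≟_ to _≟ᶠ_)
open import Data.Bool using (true; false; if_then_else_)
open import Data.List using (List; []; _∷_; map; concat; concatMap; filter; allFin; tabulate; length; _++_)
open import Data.Vec.Functional using (removeAt) renaming (_∷_ to _∷ᶠ_)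
open import Data.Product using (_×_; _,_)
open import Data.Sum using (_⊎_; inj₁; inj₂)
open import Function using (_∘_; _∘₂_; _⇔_; mk⇔)
open import Relation.Nullary using (¬_; Dec; does; yes; no; contradiction)
open import Relation.Nullary.Decidable using (_×-dec_; ¬?; does-⇔; dec-true; dec-false)
open import Relation.Binary.PropositionalEquality
open import Algebra.Properties.CommutativeSemigroup ℤP.+-commutativeSemigroup
  using () renaming (interchange to +-interchange)
open import Algebra.Properties.Semiring.Sum ℤP.+-*-semiring
  using (sum; sum-syntax; sum-cong-≗; ∑-distrib-+; *-distribˡ-sum; sum-remove)
open ≡-Reasoning

𝟙 : ∀ {P : Set} → Dec P → ℤ
𝟙 P? = if does P? then + 1 else + 0

𝟙-⇔ : ∀ {P Q : Set} → P ⇔ Q → (P? : Dec P) (Q? : Dec Q) → 𝟙 P? ≡ 𝟙 Q?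
𝟙-⇔ P⇔Q P? Q? = cong (λ b → if b then + 1 else + 0) (does-⇔ P⇔Q P? Q?)

𝟙-× : ∀ {P Q : Set} (P? : Dec P) (Q? : Dec Q) → 𝟙 (P? ×-dec Q?) ≡ 𝟙 P? * 𝟙 Q?
𝟙-× P? Q? with does P? | does Q?
... | true  | true  = refl
... | true  | false = refl
... | false | _     = refl

𝟙-yes : ∀ {P : Set} (P? : Dec P) → P → 𝟙 P? ≡ + 1
𝟙-yes P? p rewrite dec-true P? p = refl

𝟙-no : ∀ {P : Set} (P? : Dec P) → ¬ P → 𝟙 P? ≡ + 0
𝟙-no P? ¬p rewrite dec-false P? ¬p = refl

𝟙≢0⇒ : ∀ {P : Set} (P? : Dec P) → 𝟙 P? ≢ + 0 → P
𝟙≢0⇒ (yes p) _    = p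
𝟙≢0⇒ (no _)  1≢0 = contradiction refl 1≢0

+[1+n]-1≡+n : ∀ n → + suc n - + 1 ≡ + n
+[1+n]-1≡+n n = trans (ℤP.m-n≡m⊖n (suc n) 1) (trans (ℤP.[1+m]⊖[1+n]≡m⊖n n 0) (ℤP.⊖-≥ z≤n))

+[m∸n]≡+m-+n : ∀ {m n} → n ≤ m → + (m ∸ n) ≡ + m - + n
+[m∸n]≡+m-+n {m} {n} n≤m = sym (trans (ℤP.m-n≡m⊖n m n) (ℤP.⊖-≥ n≤m))

x-y≡z⇒y≡x-z : ∀ x {y z : ℤ} → x - y ≡ z → y ≡ x - z
x-y≡z⇒y≡x-z x {y} refl = involutive x y
  where involutive : ∀ x y → y ≡ x - (x - y)
        involutive = solve-∀

∑-const-1 : ∀ n → ∑[ c < n ] (+ 1) ≡ + n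
∑-const-1 zero    = refl
∑-const-1 (suc n) = cong (_+_ (+ 1)) (∑-const-1 n)

∑-linear : ∀ {n} x (f g : Fin n → ℤ) → ∑[ c < n ] (x * f c + g c) ≡ x * ∑[ c < n ] f c + ∑[ c < n ] g c
∑-linear x f g = trans (∑-distrib-+ (λ c → x * f c) g) (cong (_+ sum g) (sym (*-distribˡ-sum x f)))

sum-removeAt : ∀ {n} (t : Fin (suc n) → ℤ) j → sum (removeAt t j) ≡ sum t - t j
sum-removeAt t j = trans (cancel (t j) (sum (removeAt t j))) (cong (_- t j) (sym (sum-remove {i = j} t)))
  where cancel : ∀ x s → s ≡ x + s - x
        cancel = solve-∀

∑-punchIn : ∀ {n} (j : Fin (suc n)) (t : Fin (suc n) → ℤ) →
            ∑[ c < suc n ] (𝟙 (¬? (c ≟ᶠ j)) * t c) ≡ ∑[ c < n ] t (punchIn j c)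
∑-punchIn {n} j t = begin
  ∑[ c < suc n ] (𝟙 (¬? (c ≟ᶠ j)) * t c)
    ≡⟨ sum-remove {i = j} (λ c → 𝟙 (¬? (c ≟ᶠ j)) * t c) ⟩
  𝟙 (¬? (j ≟ᶠ j)) * t j + ∑[ c < n ] (𝟙 (¬? (punchIn j c ≟ᶠ j)) * t (punchIn j c))
    ≡⟨ cong₂ _+_ (cong (_* t j) (𝟙-no (¬? (j ≟ᶠ j)) (λ j≢j → j≢j refl)))
                 (sum-cong-≗ λ c → cong (_* t (punchIn j c)) (𝟙-yes (¬? (punchIn j c ≟ᶠ j)) (FinP.punchInᵢ≢i j c))) ⟩
  + 0 * t j + ∑[ c < n ] (+ 1 * t (punchIn j c))
    ≡⟨ cong₂ _+_ (ℤP.*-zeroˡ (t j)) (sum-cong-≗ λ c → ℤP.*-identityˡ (t (punchIn j c))) ⟩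
  + 0 + ∑[ c < n ] t (punchIn j c)
    ≡⟨ ℤP.+-identityˡ _ ⟩
  ∑[ c < n ] t (punchIn j c) ∎

∑ˡ : ∀ {A : Set} → List A → (A → ℤ) → ℤ
∑ˡ []       g = + 0
∑ˡ (x ∷ xs) g = g x + ∑ˡ xs g

module _ {A : Set} where

  ∑ˡ-cong : ∀ xs {f g : A → ℤ} → (∀ x → f x ≡ g x) → ∑ˡ xs f ≡ ∑ˡ xs g
  ∑ˡ-cong []       f≗g = refl
  ∑ˡ-cong (x ∷ xs) f≗g = cong₂ _+_ (f≗g x) (∑ˡ-cong xs f≗g)

  ∑ˡ-*ˡ : ∀ xs c (g : A → ℤ) → ∑ˡ xs (λ x → c * g x) ≡ c * ∑ˡ xs g
  ∑ˡ-*ˡ []       c g = sym (ℤP.*-zeroʳ c)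
  ∑ˡ-*ˡ (x ∷ xs) c g = trans (cong (_+_ (c * g x)) (∑ˡ-*ˡ xs c g)) (sym (ℤP.*-distribˡ-+ c _ _))

  ∑ˡ-++ : ∀ xs ys (g : A → ℤ) → ∑ˡ (xs ++ ys) g ≡ ∑ˡ xs g + ∑ˡ ys g
  ∑ˡ-++ []       ys g = sym (ℤP.+-identityˡ _)
  ∑ˡ-++ (x ∷ xs) ys g = trans (cong (_+_ (g x)) (∑ˡ-++ xs ys g)) (sym (ℤP.+-assoc (g x) _ _))

  ∑ˡ-concat : ∀ xss (g : A → ℤ) → ∑ˡ (concat xss) g ≡ ∑ˡ xss (λ xs → ∑ˡ xs g)
  ∑ˡ-concat []         g = refl
  ∑ˡ-concat (xs ∷ xss) g = trans (∑ˡ-++ xs (concat xss) g) (cong (_+_ (∑ˡ xs g)) (∑ˡ-concat xss g))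

  ∑ˡ-map : ∀ {B : Set} (h : B → A) xs (g : A → ℤ) → ∑ˡ (map h xs) g ≡ ∑ˡ xs (g ∘ h)
  ∑ˡ-map h []       g = refl
  ∑ˡ-map h (x ∷ xs) g = cong (_+_ (g (h x))) (∑ˡ-map h xs g)

  sumℤ-map-filter : ∀ {P : A → Set} (P? : ∀ x → Dec (P x)) xs (g : A → ℤ) →
                    sumℤ (map g (filter P? xs)) ≡ ∑ˡ xs (λ x → 𝟙 (P? x) * g x)
  sumℤ-map-filter P? []       g = refl
  sumℤ-map-filter P? (x ∷ xs) g with does (P? x)
  ... | true  = cong₂ _+_ (sym (ℤP.*-identityˡ (g x))) (sumℤ-map-filter P? xs g)
  ... | false = trans (sumℤ-map-filter P? xs g) (sym (ℤP.+-identityˡ _))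

  length-filter : ∀ {P : A → Set} (P? : ∀ x → Dec (P x)) xs →
                  + length (filter P? xs) ≡ ∑ˡ xs (λ x → 𝟙 (P? x))
  length-filter P? []       = refl
  length-filter P? (x ∷ xs) with does (P? x)
  ... | true  = cong (_+_ (+ 1)) (length-filter P? xs)
  ... | false = trans (length-filter P? xs) (sym (ℤP.+-identityˡ _))

∑ˡ-tabulate : ∀ {A : Set} n (h : Fin n → A) (g : A → ℤ) → ∑ˡ (tabulate h) g ≡ ∑[ j < n ] g (h j)
∑ˡ-tabulate zero    h g = refl
∑ˡ-tabulate (suc n) h g = cong (_+_ (g (h zero))) (∑ˡ-tabulate n (h ∘ suc) g)

∑ˡ-allFin : ∀ n (g : Fin n → ℤ) → ∑ˡ (allFin n) g ≡ ∑[ j < n ] g j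
∑ˡ-allFin n = ∑ˡ-tabulate n (λ j → j)

-- Laplace expansion of the permanent

-- allFuns builds its functions with pattern lambdas, so sums over it can only be
-- rewritten up to pointwise equality of the summed functions.
Extensional : ∀ {k n} → ((Fin k → Fin n) → ℤ) → Set
Extensional G = ∀ {f g} → f ≗ g → G f ≡ G g

≗-head∷tail : ∀ {k} {A : Set} (g : Fin (suc k) → A) → g ≗ (g zero ∷ᶠ (g ∘ suc))
≗-head∷tail g zero    = refl
≗-head∷tail g (suc i) = refl

∑ˡ-concatMap-map : ∀ {A B C : Set} (c : B → C → A) xs ys (g : A → ℤ) →
                   ∑ˡ (concatMap (λ x → map (c x) ys) xs) g ≡ ∑ˡ xs (λ x → ∑ˡ ys (g ∘ c x))
∑ˡ-concatMap-map c xs ys g = begin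
  ∑ˡ (concat (map (λ x → map (c x) ys) xs)) g    ≡⟨ ∑ˡ-concat (map (λ x → map (c x) ys) xs) g ⟩
  ∑ˡ (map (λ x → map (c x) ys) xs) (λ l → ∑ˡ l g) ≡⟨ ∑ˡ-map (λ x → map (c x) ys) xs _ ⟩
  ∑ˡ xs (λ x → ∑ˡ (map (c x) ys) g)               ≡⟨ ∑ˡ-cong xs (λ x → ∑ˡ-map (c x) ys g) ⟩
  ∑ˡ xs (λ x → ∑ˡ ys (g ∘ c x))                   ∎

∑ˡ-allFuns-suc : ∀ k n (G : (Fin (suc k) → Fin n) → ℤ) → Extensional G →
                 ∑ˡ (allFuns (suc k) n) G ≡ ∑[ j < n ] ∑ˡ (allFuns k n) (λ f → G (j ∷ᶠ f))
∑ˡ-allFuns-suc k n G ext = expand _ (λ j f → ≗-head∷tail _)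
  where
  expand : (c : Fin n → (Fin k → Fin n) → Fin (suc k) → Fin n) → (∀ j f → c j f ≗ (j ∷ᶠ f)) →
           ∑ˡ (concatMap (λ j → map (c j) (allFuns k n)) (allFin n)) G
             ≡ ∑[ j < n ] ∑ˡ (allFuns k n) (λ f → G (j ∷ᶠ f))
  expand c c≗∷ = begin
    ∑ˡ (concatMap (λ j → map (c j) (allFuns k n)) (allFin n)) G ≡⟨ ∑ˡ-concatMap-map c (allFin n) (allFuns k n) G ⟩
    ∑ˡ (allFin n) (λ j → ∑ˡ (allFuns k n) (G ∘ c j))            ≡⟨ ∑ˡ-allFin n _ ⟩
    ∑[ j < n ] ∑ˡ (allFuns k n) (G ∘ c j)
      ≡⟨ sum-cong-≗ (λ j → ∑ˡ-cong (allFuns k n) (λ f → ext (c≗∷ j f))) ⟩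
    ∑[ j < n ] ∑ˡ (allFuns k n) (λ f → G (j ∷ᶠ f))              ∎

Avoids : ∀ {k n} → Fin n → (Fin k → Fin n) → Set
Avoids j f = ∀ i → f i ≢ j

avoids? : ∀ {k n} (j : Fin n) (f : Fin k → Fin n) → Dec (Avoids j f)
avoids? j f = FinP.all? λ i → ¬? (f i ≟ᶠ j)

Inj-≗ : ∀ {k n} {f g : Fin k → Fin n} → f ≗ g → Inj f → Inj g
Inj-≗ f≗g inj i i′ eq = inj i i′ (trans (f≗g i) (trans eq (sym (f≗g i′))))

Inj-∷ᶠ : ∀ {k n} (j : Fin n) (f : Fin k → Fin n) → Inj (j ∷ᶠ f) ⇔ (Avoids j f × Inj f)
Inj-∷ᶠ j f = mk⇔ split join
  where
  split : Inj (j ∷ᶠ f) → Avoids j f × Inj f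
  split inj = (λ i fi≡j → FinP.0≢1+n (sym (inj (suc i) zero fi≡j)))
            , (λ i i′ eq → FinP.suc-injective (inj (suc i) (suc i′) eq))
  join : Avoids j f × Inj f → Inj (j ∷ᶠ f)
  join (avoid , inj) zero    zero     _  = refl
  join (avoid , inj) zero    (suc i′) eq = contradiction (sym eq) (avoid i′)
  join (avoid , inj) (suc i) zero     eq = contradiction eq (avoid i)
  join (avoid , inj) (suc i) (suc i′) eq = cong suc (inj i i′ eq)

Inj-punchIn : ∀ {k n} (j : Fin (suc n)) (f : Fin k → Fin n) → Inj (punchIn j ∘ f) ⇔ Inj f
Inj-punchIn j f = mk⇔ (λ inj i i′ eq → inj i i′ (cong (punchIn j) eq))
                      (λ inj i i′ eq → inj i i′ (FinP.punchIn-injective j _ _ eq))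

Avoids-∷ᶠ : ∀ {k n} (j c : Fin n) (f : Fin k → Fin n) → Avoids j (c ∷ᶠ f) ⇔ (c ≢ j × Avoids j f)
Avoids-∷ᶠ j c f = mk⇔ (λ avoid → avoid zero , avoid ∘ suc)
                      (λ { (c≢j , avoid) zero → c≢j ; (c≢j , avoid) (suc i) → avoid i })

∑ˡ-allFuns-avoiding : ∀ k n (j : Fin (suc n)) (G : (Fin k → Fin (suc n)) → ℤ) → Extensional G →
                      ∑ˡ (allFuns k (suc n)) (λ f → 𝟙 (avoids? j f) * G f)
                        ≡ ∑ˡ (allFuns k n) (λ f → G (punchIn j ∘ f))
∑ˡ-allFuns-avoiding zero n j G ext =
  cong (_+ + 0) (trans (ℤP.*-identityˡ _) (ext λ ()))
∑ˡ-allFuns-avoiding (suc k) n j G ext = begin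
  ∑ˡ (allFuns (suc k) (suc n)) (λ f → 𝟙 (avoids? j f) * G f)
    ≡⟨ ∑ˡ-allFuns-suc k (suc n) _ avoiding-extensional ⟩
  ∑[ c < suc n ] ∑ˡ (allFuns k (suc n)) (λ f → 𝟙 (avoids? j (c ∷ᶠ f)) * G (c ∷ᶠ f))
    ≡⟨ sum-cong-≗ (λ c → trans (∑ˡ-cong (allFuns k (suc n)) (split c))
                               (∑ˡ-*ˡ (allFuns k (suc n)) (𝟙 (c≢j? c)) (λ f → 𝟙 (avoids? j f) * G (c ∷ᶠ f)))) ⟩
  ∑[ c < suc n ] (𝟙 (c≢j? c) * ∑ˡ (allFuns k (suc n)) (λ f → 𝟙 (avoids? j f) * G (c ∷ᶠ f)))
    ≡⟨ sum-cong-≗ (λ c → cong (𝟙 (c≢j? c) *_)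
                              (∑ˡ-allFuns-avoiding k n j (G ∘ (c ∷ᶠ_)) (λ f≗g → ext (∷ᶠ-≗ c f≗g)))) ⟩
  ∑[ c < suc n ] (𝟙 (c≢j? c) * ∑ˡ (allFuns k n) (λ f → G (c ∷ᶠ (punchIn j ∘ f))))
    ≡⟨ ∑-punchIn j (λ c → ∑ˡ (allFuns k n) (λ f → G (c ∷ᶠ (punchIn j ∘ f)))) ⟩
  ∑[ c < n ] ∑ˡ (allFuns k n) (λ f → G (punchIn j c ∷ᶠ (punchIn j ∘ f)))
    ≡⟨ sum-cong-≗ (λ c → ∑ˡ-cong (allFuns k n) λ f → ext (punchIn-∷ᶠ c f)) ⟨
  ∑[ c < n ] ∑ˡ (allFuns k n) (λ f → G (punchIn j ∘ (c ∷ᶠ f)))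
    ≡⟨ ∑ˡ-allFuns-suc k n (G ∘ (punchIn j ∘_)) (λ f≗g → ext (cong (punchIn j) ∘ f≗g)) ⟨
  ∑ˡ (allFuns (suc k) n) (λ f → G (punchIn j ∘ f)) ∎
  where
  c≢j? : ∀ c → Dec (c ≢ j)
  c≢j? c = ¬? (c ≟ᶠ j)
  avoiding-extensional : Extensional (λ f → 𝟙 (avoids? j f) * G f)
  avoiding-extensional {f} {g} f≗g = cong₂ _*_ (𝟙-⇔ Avoids-f⇔g (avoids? j f) (avoids? j g)) (ext f≗g)
    where Avoids-f⇔g = mk⇔ (λ avoid i gi≡j → avoid i (trans (f≗g i) gi≡j))
                           (λ avoid i fi≡j → avoid i (trans (sym (f≗g i)) fi≡j))
  split : ∀ c f → 𝟙 (avoids? j (c ∷ᶠ f)) * G (c ∷ᶠ f) ≡ 𝟙 (c≢j? c) * (𝟙 (avoids? j f) * G (c ∷ᶠ f))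
  split c f = begin
    𝟙 (avoids? j (c ∷ᶠ f)) * G (c ∷ᶠ f)
      ≡⟨ cong (_* G (c ∷ᶠ f)) (trans (𝟙-⇔ (Avoids-∷ᶠ j c f) (avoids? j (c ∷ᶠ f)) (c≢j? c ×-dec avoids? j f))
                                     (𝟙-× (c≢j? c) (avoids? j f))) ⟩
    𝟙 (c≢j? c) * 𝟙 (avoids? j f) * G (c ∷ᶠ f)
      ≡⟨ ℤP.*-assoc (𝟙 (c≢j? c)) (𝟙 (avoids? j f)) (G (c ∷ᶠ f)) ⟩
    𝟙 (c≢j? c) * (𝟙 (avoids? j f) * G (c ∷ᶠ f)) ∎
  ∷ᶠ-≗ : ∀ c {f g : Fin k → Fin (suc n)} → f ≗ g → (c ∷ᶠ f) ≗ (c ∷ᶠ g)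
  ∷ᶠ-≗ c f≗g zero    = refl
  ∷ᶠ-≗ c f≗g (suc i) = f≗g i
  punchIn-∷ᶠ : ∀ c f → (punchIn j ∘ (c ∷ᶠ f)) ≗ (punchIn j c ∷ᶠ (punchIn j ∘ f))
  punchIn-∷ᶠ c f zero    = refl
  punchIn-∷ᶠ c f (suc i) = refl

prodFin-cong : ∀ k {g h : Fin k → ℤ} → (∀ i → g i ≡ h i) → prodFin k g ≡ prodFin k h
prodFin-cong zero    g≗h = refl
prodFin-cong (suc k) g≗h = cong₂ _*_ (g≗h zero) (prodFin-cong k (g≗h ∘ suc))

per-term : ∀ {k n} → (Fin k → Fin n → ℤ) → (Fin k → Fin n) → ℤ
per-term {k} A f = 𝟙 (inj? f) * prodFin k (λ i → A i (f i))

per-term-extensional : ∀ {k n} (A : Fin k → Fin n → ℤ) → Extensional (per-term A)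
per-term-extensional {k} A {f} {g} f≗g =
  cong₂ _*_ (𝟙-⇔ (mk⇔ (Inj-≗ f≗g) (Inj-≗ (sym ∘ f≗g))) (inj? f) (inj? g))
            (prodFin-cong k (cong (A _) ∘ f≗g))

per≡∑ˡ-per-term : ∀ {k n} (A : Fin k → Fin n → ℤ) → per A ≡ ∑ˡ (allFuns k n) (per-term A)
per≡∑ˡ-per-term {k} {n} A = sumℤ-map-filter inj? (allFuns k n) _

per-cong : ∀ {k n} {A A′ : Fin k → Fin n → ℤ} → (∀ i c → A i c ≡ A′ i c) → per A ≡ per A′
per-cong {k} {n} {A} {A′} A≗A′ = begin
  per A                           ≡⟨ per≡∑ˡ-per-term A ⟩
  ∑ˡ (allFuns k n) (per-term A)
    ≡⟨ ∑ˡ-cong (allFuns k n) (λ f → cong (𝟙 (inj? f) *_) (prodFin-cong k λ i → A≗A′ i (f i))) ⟩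
  ∑ˡ (allFuns k n) (per-term A′)  ≡⟨ per≡∑ˡ-per-term A′ ⟨
  per A′                          ∎

per-expand-first-row : ∀ {k n} (A : Fin (suc k) → Fin (suc n) → ℤ) →
                       per A ≡ ∑[ j < suc n ] (A zero j * per (λ i → removeAt (A (suc i)) j))
per-expand-first-row {k} {n} A = begin
  per A
    ≡⟨ per≡∑ˡ-per-term A ⟩
  ∑ˡ (allFuns (suc k) (suc n)) (per-term A)
    ≡⟨ ∑ˡ-allFuns-suc k (suc n) (per-term A) (per-term-extensional A) ⟩
  ∑[ j < suc n ] ∑ˡ (allFuns k (suc n)) (λ f → per-term A (j ∷ᶠ f))
    ≡⟨ sum-cong-≗ (λ j → trans (∑ˡ-cong (allFuns k (suc n)) (split j))
                               (∑ˡ-*ˡ (allFuns k (suc n)) (A zero j) (λ f → 𝟙 (avoids? j f) * per-term A′ f))) ⟩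
  ∑[ j < suc n ] (A zero j * ∑ˡ (allFuns k (suc n)) (λ f → 𝟙 (avoids? j f) * per-term A′ f))
    ≡⟨ sum-cong-≗ (λ j → cong (A zero j *_) (∑ˡ-allFuns-avoiding k n j (per-term A′) (per-term-extensional A′))) ⟩
  ∑[ j < suc n ] (A zero j * ∑ˡ (allFuns k n) (λ f → per-term A′ (punchIn j ∘ f)))
    ≡⟨ sum-cong-≗ (λ j → cong (A zero j *_) (trans (∑ˡ-cong (allFuns k n) (unpunch j))
                                                  (sym (per≡∑ˡ-per-term (λ i → removeAt (A′ i) j))))) ⟩
  ∑[ j < suc n ] (A zero j * per (λ i → removeAt (A′ i) j)) ∎
  where
  A′ = A ∘ suc
  split : ∀ j f → per-term A (j ∷ᶠ f) ≡ A zero j * (𝟙 (avoids? j f) * per-term A′ f)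
  split j f = begin
    𝟙 (inj? (j ∷ᶠ f)) * (A zero j * P)
      ≡⟨ cong (_* (A zero j * P)) (trans (𝟙-⇔ (Inj-∷ᶠ j f) (inj? (j ∷ᶠ f)) (avoids? j f ×-dec inj? f))
                                         (𝟙-× (avoids? j f) (inj? f))) ⟩
    𝟙 (avoids? j f) * 𝟙 (inj? f) * (A zero j * P)
      ≡⟨ reorder (𝟙 (avoids? j f)) (𝟙 (inj? f)) (A zero j) P ⟩
    A zero j * (𝟙 (avoids? j f) * (𝟙 (inj? f) * P)) ∎
    where
    P = prodFin k (λ i → A′ i (f i))
    reorder : ∀ a b x p → a * b * (x * p) ≡ x * (a * (b * p))
    reorder = solve-∀
  unpunch : ∀ j f → per-term A′ (punchIn j ∘ f) ≡ per-term (λ i → removeAt (A′ i) j) f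
  unpunch j f = cong (_* prodFin k (λ i → A′ i (punchIn j (f i)))) (𝟙-⇔ (Inj-punchIn j f) (inj? (punchIn j ∘ f)) (inj? f))

-- The permanent as a polynomial in the row sums

-- perPoly k m a = per (J − 2N) for every k × m matrix N with column-disjoint supports and
-- row sums a (per-J-2N).
perPoly : (k : ℕ) → ℤ → (Fin k → ℤ) → ℤ
perPoly zero    m a = + 1
perPoly (suc k) m a = (m - + k) * perPoly k m (a ∘ suc) - + 2 * a zero * perPoly k (m - + 1) (a ∘ suc)

-- ∑ᵢ aᵢ ∂perPoly/∂aᵢ, unfolded along the recursion of perPoly.
euler-perPoly : (k : ℕ) → ℤ → (Fin k → ℤ) → ℤ
euler-perPoly zero    m a = + 0
euler-perPoly (suc k) m a =
  (m - + k) * euler-perPoly k m (a ∘ suc)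
    - + 2 * a zero * (perPoly k (m - + 1) (a ∘ suc) + euler-perPoly k (m - + 1) (a ∘ suc))

perPoly-cong : ∀ k m {a b : Fin k → ℤ} → (∀ i → a i ≡ b i) → perPoly k m a ≡ perPoly k m b
perPoly-cong zero    m a≗b = refl
perPoly-cong (suc k) m a≗b =
  cong₂ (λ p q → (m - + k) * p - q) (perPoly-cong k m (a≗b ∘ suc))
        (cong₂ (λ a₀ p → + 2 * a₀ * p) (a≗b zero) (perPoly-cong k (m - + 1) (a≗b ∘ suc)))

perPoly-pred : ∀ k m a → m * perPoly k (m - + 1) a - euler-perPoly k (m - + 1) a ≡ (m - + k) * perPoly k m a
perPoly-pred zero    m a = unit m
  where unit : ∀ m → m * + 1 - + 0 ≡ (m - + 0) * + 1
        unit = solve-∀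
perPoly-pred (suc k) m a = begin
  m * ((m - + 1 - + k) * x - + 2 * a₀ * u) - ((m - + 1 - + k) * y - + 2 * a₀ * (u + v))
    ≡⟨ cong₂ (λ y v → m * ((m - + 1 - + k) * x - + 2 * a₀ * u) - ((m - + 1 - + k) * y - + 2 * a₀ * (u + v)))
             (x-y≡z⇒y≡x-z (m * x) (perPoly-pred k m a′)) (x-y≡z⇒y≡x-z ((m - + 1) * u) (perPoly-pred k (m - + 1) a′)) ⟩
  m * ((m - + 1 - + k) * x - + 2 * a₀ * u)
    - ((m - + 1 - + k) * (m * x - (m - + k) * h) - + 2 * a₀ * (u + ((m - + 1) * u - (m - + 1 - + k) * x)))
    ≡⟨ collect m (+ k) a₀ h x u ⟩
  (m - + suc k) * ((m - + k) * h - + 2 * a₀ * x) ∎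
  where
  a₀ = a zero
  a′ = a ∘ suc
  h = perPoly k m a′
  x = perPoly k (m - + 1) a′
  u = perPoly k (m - + 1 - + 1) a′
  y = euler-perPoly k (m - + 1) a′
  v = euler-perPoly k (m - + 1 - + 1) a′
  collect : ∀ m k a₀ h x u →
    m * ((m - + 1 - k) * x - + 2 * a₀ * u)
      - ((m - + 1 - k) * (m * x - (m - k) * h) - + 2 * a₀ * (u + ((m - + 1) * u - (m - + 1 - k) * x)))
    ≡ (m - (+ 1 + k)) * ((m - k) * h - + 2 * a₀ * x)
  collect = solve-∀

rowSum : ∀ {k n} → (Fin k → Fin n → ℤ) → Fin k → ℤ
rowSum {n = n} N i = ∑[ c < n ] N i c

ColumnDisjoint : ∀ {k n} → (Fin k → Fin n → ℤ) → Set
ColumnDisjoint N = ∀ c i i′ → N i c ≢ + 0 → N i′ c ≢ + 0 → i ≡ i′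

ColumnDisjoint-tail : ∀ {k n} {N : Fin (suc k) → Fin n → ℤ} → ColumnDisjoint N → ColumnDisjoint (N ∘ suc)
ColumnDisjoint-tail disj c i i′ p q = FinP.suc-injective (disj c (suc i) (suc i′) p q)

*-perPoly-column : ∀ k {n} (N : Fin (suc k) → Fin n → ℤ) → ColumnDisjoint N → ∀ c m (a : Fin k → ℤ) →
                   N zero c * perPoly k m (λ i → a i - N (suc i) c) ≡ N zero c * perPoly k m a
*-perPoly-column k N disj c m a with N zero c ℤP.≟ + 0
... | yes N₀c≡0 rewrite N₀c≡0 = refl
... | no  N₀c≢0 = cong (N zero c *_) (perPoly-cong k m below-is-zero)
  where
  below-is-zero : ∀ i → a i - N (suc i) c ≡ a i
  below-is-zero i with N (suc i) c ℤP.≟ + 0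
  ... | yes Nᵢc≡0 rewrite Nᵢc≡0 = ℤP.+-identityʳ (a i)
  ... | no  Nᵢc≢0 = contradiction (disj c zero (suc i) N₀c≢0 Nᵢc≢0) λ ()

∑-perPoly-minus-column : ∀ k {n} (N : Fin k → Fin n → ℤ) → ColumnDisjoint N → ∀ m →
  ∑[ c < n ] perPoly k m (λ i → rowSum N i - N i c)
    ≡ + n * perPoly k m (rowSum N) - euler-perPoly k m (rowSum N)
∑-perPoly-minus-column zero {n} N disj m = begin
  ∑[ c < n ] (+ 1)     ≡⟨ ∑-const-1 n ⟩
  + n                  ≡⟨ unit (+ n) ⟩
  + n * + 1 - + 0      ∎
  where unit : ∀ x → x ≡ x * + 1 - + 0
        unit = solve-∀
∑-perPoly-minus-column (suc k) {n} N disj m = begin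
  ∑[ c < n ] ((m - + k) * X c - + 2 * (a₀ - N zero c) * Y c)
    ≡⟨ sum-cong-≗ expand ⟩
  ∑[ c < n ] ((m - + k) * X c + (- (+ 2 * a₀) * Y c + (+ 2 * y) * N zero c))
    ≡⟨ ∑-linear (m - + k) X (λ c → - (+ 2 * a₀) * Y c + (+ 2 * y) * N zero c) ⟩
  (m - + k) * sum X + ∑[ c < n ] (- (+ 2 * a₀) * Y c + (+ 2 * y) * N zero c)
    ≡⟨ cong (_+_ ((m - + k) * sum X))
            (trans (∑-linear (- (+ 2 * a₀)) Y (λ c → (+ 2 * y) * N zero c))
                   (cong (_+_ (- (+ 2 * a₀) * sum Y)) (sym (*-distribˡ-sum (+ 2 * y) (N zero))))) ⟩
  (m - + k) * sum X + (- (+ 2 * a₀) * sum Y + (+ 2 * y) * a₀)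
    ≡⟨ cong₂ (λ p q → (m - + k) * p + (- (+ 2 * a₀) * q + (+ 2 * y) * a₀))
             (∑-perPoly-minus-column k N′ (ColumnDisjoint-tail disj) m)
             (∑-perPoly-minus-column k N′ (ColumnDisjoint-tail disj) (m - + 1)) ⟩
  (m - + k) * (+ n * x - x′) + (- (+ 2 * a₀) * (+ n * y - y′) + (+ 2 * y) * a₀)
    ≡⟨ collect (m - + k) (+ n) x x′ y y′ a₀ ⟩
  + n * ((m - + k) * x - + 2 * a₀ * y) - ((m - + k) * x′ - + 2 * a₀ * (y + y′)) ∎
  where
  N′ = N ∘ suc
  a₀ = rowSum N zero
  a′ = rowSum N′
  x  = perPoly k m a′
  x′ = euler-perPoly k m a′
  y  = perPoly k (m - + 1) a′
  y′ = euler-perPoly k (m - + 1) a′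
  X Y : Fin n → ℤ
  X c = perPoly k m (λ i → a′ i - N′ i c)
  Y c = perPoly k (m - + 1) (λ i → a′ i - N′ i c)
  expand : ∀ c → (m - + k) * X c - + 2 * (a₀ - N zero c) * Y c
               ≡ (m - + k) * X c + (- (+ 2 * a₀) * Y c + (+ 2 * y) * N zero c)
  expand c = begin
    (m - + k) * X c - + 2 * (a₀ - N zero c) * Y c
      ≡⟨ distrib (m - + k) (X c) a₀ (N zero c) (Y c) ⟩
    (m - + k) * X c + (- (+ 2 * a₀) * Y c + + 2 * (N zero c * Y c))
      ≡⟨ cong (λ z → (m - + k) * X c + (- (+ 2 * a₀) * Y c + + 2 * z))
              (*-perPoly-column k N disj c (m - + 1) a′) ⟩
    (m - + k) * X c + (- (+ 2 * a₀) * Y c + + 2 * (N zero c * y))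
      ≡⟨ cong (λ z → (m - + k) * X c + (- (+ 2 * a₀) * Y c + z)) (reorder (N zero c) y) ⟩
    (m - + k) * X c + (- (+ 2 * a₀) * Y c + (+ 2 * y) * N zero c) ∎
    where
    distrib : ∀ s p a₀ d q → s * p - + 2 * (a₀ - d) * q ≡ s * p + (- (+ 2 * a₀) * q + + 2 * (d * q))
    distrib = solve-∀
    reorder : ∀ d q → + 2 * (d * q) ≡ (+ 2 * q) * d
    reorder = solve-∀
  collect : ∀ s n x x′ y y′ a₀ → s * (n * x - x′) + (- (+ 2 * a₀) * (n * y - y′) + (+ 2 * y) * a₀)
                               ≡ n * (s * x - + 2 * a₀ * y) - (s * x′ - + 2 * a₀ * (y + y′))
  collect = solve-∀

per-J-2N : ∀ k n (N : Fin k → Fin n → ℤ) → ColumnDisjoint N → k ≤ n →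
           per (λ i c → + 1 - + 2 * N i c) ≡ perPoly k (+ n) (rowSum N)
per-J-2N zero    n       N disj z≤n       = refl
per-J-2N (suc k) (suc n) N disj (s≤s k≤n) = begin
  per A
    ≡⟨ per-expand-first-row A ⟩
  ∑[ j < suc n ] (A zero j * per (λ i → removeAt (A (suc i)) j))
    ≡⟨ sum-cong-≗ (λ j → cong (A zero j *_) (minor j)) ⟩
  ∑[ j < suc n ] ((+ 1 - + 2 * N zero j) * perPoly k (m - + 1) (λ i → a′ i - N′ i j))
    ≡⟨ sum-cong-≗ expand ⟩
  ∑[ j < suc n ] (perPoly k (m - + 1) (λ i → a′ i - N′ i j) + - (+ 2 * y) * N zero j)
    ≡⟨ ∑-distrib-+ (λ j → perPoly k (m - + 1) (λ i → a′ i - N′ i j)) (λ j → - (+ 2 * y) * N zero j) ⟩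
  ∑[ j < suc n ] perPoly k (m - + 1) (λ i → a′ i - N′ i j) + ∑[ j < suc n ] (- (+ 2 * y) * N zero j)
    ≡⟨ cong₂ _+_ (∑-perPoly-minus-column k N′ (ColumnDisjoint-tail disj) (m - + 1))
                 (sym (*-distribˡ-sum (- (+ 2 * y)) (N zero))) ⟩
  (m * y - euler-perPoly k (m - + 1) a′) + - (+ 2 * y) * a₀
    ≡⟨ cong (_+ - (+ 2 * y) * a₀) (perPoly-pred k m a′) ⟩
  (m - + k) * perPoly k m a′ + - (+ 2 * y) * a₀
    ≡⟨ collect ((m - + k) * perPoly k m a′) y a₀ ⟩
  perPoly (suc k) m (rowSum N) ∎
  where
  A : Fin (suc k) → Fin (suc n) → ℤ
  A i c = + 1 - + 2 * N i c
  m = + suc n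
  N′ = N ∘ suc
  a₀ = rowSum N zero
  a′ = rowSum N′
  y = perPoly k (m - + 1) a′
  minor : ∀ j → per (λ i → removeAt (A (suc i)) j) ≡ perPoly k (m - + 1) (λ i → a′ i - N′ i j)
  minor j = begin
    per (λ i → removeAt (A (suc i)) j)
      ≡⟨ per-J-2N k n (λ i → removeAt (N′ i) j)
                  (λ c i i′ → FinP.suc-injective ∘₂ disj (punchIn j c) (suc i) (suc i′)) k≤n ⟩
    perPoly k (+ n) (rowSum (λ i → removeAt (N′ i) j))
      ≡⟨ cong (λ m′ → perPoly k m′ (rowSum (λ i → removeAt (N′ i) j))) (sym (+[1+n]-1≡+n n)) ⟩
    perPoly k (m - + 1) (rowSum (λ i → removeAt (N′ i) j))
      ≡⟨ perPoly-cong k (m - + 1) (λ i → sum-removeAt (N′ i) j) ⟩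
    perPoly k (m - + 1) (λ i → a′ i - N′ i j) ∎
  expand : ∀ j → (+ 1 - + 2 * N zero j) * perPoly k (m - + 1) (λ i → a′ i - N′ i j)
               ≡ perPoly k (m - + 1) (λ i → a′ i - N′ i j) + - (+ 2 * y) * N zero j
  expand j = begin
    (+ 1 - + 2 * d) * P           ≡⟨ distrib d P ⟩
    P + - + 2 * (d * P)           ≡⟨ cong (λ z → P + - + 2 * z) (*-perPoly-column k N disj j (m - + 1) a′) ⟩
    P + - + 2 * (d * y)           ≡⟨ reorder P d y ⟩
    P + - (+ 2 * y) * d           ∎
    where
    d = N zero j
    P = perPoly k (m - + 1) (λ i → a′ i - N′ i j)
    distrib : ∀ d P → (+ 1 - + 2 * d) * P ≡ P + - + 2 * (d * P)
    distrib = solve-∀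
    reorder : ∀ P d y → P + - + 2 * (d * y) ≡ P + - (+ 2 * y) * d
    reorder = solve-∀
  collect : ∀ s y a₀ → s + - (+ 2 * y) * a₀ ≡ s - + 2 * a₀ * y
  collect = solve-∀

-- The closed form

coeff : ℕ → ℕ → ℕ → ℤ
coeff n k ℓ = (-[1+ 1 ] ^ ℓ) * + falling (n ∸ ℓ) (k ∸ ℓ)

perClosed : ∀ k → ℕ → (Fin k → ℤ) → ℤ
perClosed k n a = sumUpTo k (λ ℓ → coeff n k ℓ * esym k ℓ a)

sumUpTo-cong : ∀ K {f g : ℕ → ℤ} → (∀ ℓ → ℓ ≤ K → f ℓ ≡ g ℓ) → sumUpTo K f ≡ sumUpTo K g
sumUpTo-cong zero    f≗g = f≗g 0 z≤n
sumUpTo-cong (suc K) f≗g =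
  cong₂ _+_ (sumUpTo-cong K (λ ℓ ℓ≤K → f≗g ℓ (ℕP.m≤n⇒m≤1+n ℓ≤K))) (f≗g (suc K) ℕP.≤-refl)

sumUpTo-+ : ∀ K (f g : ℕ → ℤ) → sumUpTo K (λ ℓ → f ℓ + g ℓ) ≡ sumUpTo K f + sumUpTo K g
sumUpTo-+ zero    f g = refl
sumUpTo-+ (suc K) f g = trans (cong (_+ (f (suc K) + g (suc K))) (sumUpTo-+ K f g))
                              (+-interchange (sumUpTo K f) (sumUpTo K g) (f (suc K)) (g (suc K)))

sumUpTo-*ˡ : ∀ K x (f : ℕ → ℤ) → sumUpTo K (λ ℓ → x * f ℓ) ≡ x * sumUpTo K f
sumUpTo-*ˡ zero    x f = refl
sumUpTo-*ˡ (suc K) x f = trans (cong (_+ x * f (suc K)) (sumUpTo-*ˡ K x f)) (sym (ℤP.*-distribˡ-+ x _ _))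

sumUpTo-suc : ∀ K (f : ℕ → ℤ) → sumUpTo (suc K) f ≡ f 0 + sumUpTo K (f ∘ suc)
sumUpTo-suc zero    f = refl
sumUpTo-suc (suc K) f = trans (cong (_+ f (suc (suc K))) (sumUpTo-suc K f)) (ℤP.+-assoc (f 0) _ _)

esym-vanishes : ∀ k ℓ (x : Fin k → ℤ) → k ℕ.< ℓ → esym k ℓ x ≡ + 0
esym-vanishes zero    (suc ℓ) x k<ℓ       = refl
esym-vanishes (suc k) (suc ℓ) x (s≤s k<ℓ) =
  trans (cong₂ (λ p q → x zero * p + q) (esym-vanishes k ℓ (x ∘ suc) k<ℓ)
                                        (esym-vanishes k (suc ℓ) (x ∘ suc) (ℕP.m≤n⇒m≤1+n k<ℓ)))
        (cong (_+ + 0) (ℤP.*-zeroʳ (x zero)))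

falling-suc : ∀ m j → falling m (suc j) ≡ falling m j ℕ.* (m ∸ j)
falling-suc m zero    = trans (ℕP.*-identityʳ m) (sym (ℕP.+-identityʳ m))
falling-suc m (suc j) = begin
  m ℕ.* falling (m ∸ 1) (suc j)                 ≡⟨ cong (m ℕ.*_) (falling-suc (m ∸ 1) j) ⟩
  m ℕ.* (falling (m ∸ 1) j ℕ.* (m ∸ 1 ∸ j))     ≡⟨ ℕP.*-assoc m _ _ ⟨
  m ℕ.* falling (m ∸ 1) j ℕ.* (m ∸ 1 ∸ j)       ≡⟨ cong (m ℕ.* falling (m ∸ 1) j ℕ.*_) (ℕP.∸-+-assoc m 1 j) ⟩
  m ℕ.* falling (m ∸ 1) j ℕ.* (m ∸ suc j)       ∎

coeff-suc : ∀ {n k ℓ} → ℓ ≤ k → k ≤ n → coeff n (suc k) ℓ ≡ (+ n - + k) * coeff n k ℓ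
coeff-suc {n} {k} {ℓ} ℓ≤k k≤n = begin
  (-[1+ 1 ] ^ ℓ) * + falling (n ∸ ℓ) (suc k ∸ ℓ)
    ≡⟨ cong (λ j → (-[1+ 1 ] ^ ℓ) * + falling (n ∸ ℓ) j) (ℕP.+-∸-assoc 1 ℓ≤k) ⟩
  (-[1+ 1 ] ^ ℓ) * + falling (n ∸ ℓ) (suc (k ∸ ℓ))
    ≡⟨ cong (λ z → (-[1+ 1 ] ^ ℓ) * + z) (falling-suc (n ∸ ℓ) (k ∸ ℓ)) ⟩
  (-[1+ 1 ] ^ ℓ) * + (falling (n ∸ ℓ) (k ∸ ℓ) ℕ.* (n ∸ ℓ ∸ (k ∸ ℓ)))
    ≡⟨ cong (λ z → (-[1+ 1 ] ^ ℓ) * + (falling (n ∸ ℓ) (k ∸ ℓ) ℕ.* z))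
            (trans (ℕP.∸-+-assoc n ℓ (k ∸ ℓ)) (cong (n ∸_) (ℕP.m+[n∸m]≡n ℓ≤k))) ⟩
  (-[1+ 1 ] ^ ℓ) * + (falling (n ∸ ℓ) (k ∸ ℓ) ℕ.* (n ∸ k))
    ≡⟨ cong ((-[1+ 1 ] ^ ℓ) *_) (trans (ℤP.pos-* (falling (n ∸ ℓ) (k ∸ ℓ)) (n ∸ k))
                                      (cong (+ falling (n ∸ ℓ) (k ∸ ℓ) *_) (+[m∸n]≡+m-+n k≤n))) ⟩
  (-[1+ 1 ] ^ ℓ) * (+ falling (n ∸ ℓ) (k ∸ ℓ) * (+ n - + k))
    ≡⟨ reorder (-[1+ 1 ] ^ ℓ) (+ falling (n ∸ ℓ) (k ∸ ℓ)) (+ n - + k) ⟩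
  (+ n - + k) * ((-[1+ 1 ] ^ ℓ) * + falling (n ∸ ℓ) (k ∸ ℓ)) ∎
  where reorder : ∀ p f d → p * (f * d) ≡ d * (p * f)
        reorder = solve-∀

∑-coeff-suc : ∀ {k n} → k ≤ n → ∀ x →
              sumUpTo k (λ ℓ → coeff n (suc k) ℓ * esym k ℓ x) ≡ (+ n - + k) * perClosed k n x
∑-coeff-suc {k} {n} k≤n x =
  trans (sumUpTo-cong k λ ℓ ℓ≤k → trans (cong (_* esym k ℓ x) (coeff-suc ℓ≤k k≤n))
                                        (ℤP.*-assoc (+ n - + k) (coeff n k ℓ) (esym k ℓ x)))
        (sumUpTo-*ˡ k (+ n - + k) (λ ℓ → coeff n k ℓ * esym k ℓ x))

∑-coeff-suc-suc : ∀ k n a₀ x →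
  sumUpTo k (λ ℓ → coeff (suc n) (suc k) (suc ℓ) * (a₀ * esym k ℓ x)) ≡ - (+ 2 * a₀) * perClosed k n x
∑-coeff-suc-suc k n a₀ x =
  trans (sumUpTo-cong k λ ℓ _ → reorder (-[1+ 1 ] ^ ℓ) (+ falling (n ∸ ℓ) (k ∸ ℓ)) a₀ (esym k ℓ x))
        (sumUpTo-*ˡ k (- (+ 2 * a₀)) (λ ℓ → coeff n k ℓ * esym k ℓ x))
  where reorder : ∀ p f a₀ e → (-[1+ 1 ] * p * f) * (a₀ * e) ≡ - (+ 2 * a₀) * (p * f * e)
        reorder = solve-∀

perClosed-suc : ∀ k n → k ≤ n → ∀ a →
  perClosed (suc k) (suc n) a
    ≡ (+ suc n - + k) * perClosed k (suc n) (a ∘ suc) - + 2 * a zero * perClosed k n (a ∘ suc)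
perClosed-suc k n k≤n a = begin
  sumUpTo (suc k) (λ ℓ → c ℓ * esym (suc k) ℓ a)
    ≡⟨ sumUpTo-suc k (λ ℓ → c ℓ * esym (suc k) ℓ a) ⟩
  c 0 * + 1 + sumUpTo k (λ ℓ → c (suc ℓ) * (a₀ * e ℓ + e (suc ℓ)))
    ≡⟨ cong (_+_ (c 0 * + 1)) (trans (sumUpTo-cong k λ ℓ _ → ℤP.*-distribˡ-+ (c (suc ℓ)) (a₀ * e ℓ) (e (suc ℓ)))
                                     (sumUpTo-+ k (λ ℓ → c (suc ℓ) * (a₀ * e ℓ)) (λ ℓ → c (suc ℓ) * e (suc ℓ)))) ⟩
  c 0 * + 1 + (sumUpTo k (λ ℓ → c (suc ℓ) * (a₀ * e ℓ)) + sumUpTo k (λ ℓ → c (suc ℓ) * e (suc ℓ)))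
    ≡⟨ regroup (c 0 * + 1) (sumUpTo k (λ ℓ → c (suc ℓ) * (a₀ * e ℓ))) (sumUpTo k (λ ℓ → c (suc ℓ) * e (suc ℓ))) ⟩
  (c 0 * + 1 + sumUpTo k (λ ℓ → c (suc ℓ) * e (suc ℓ))) + sumUpTo k (λ ℓ → c (suc ℓ) * (a₀ * e ℓ))
    ≡⟨ cong₂ _+_ (sym (sumUpTo-suc k (λ ℓ → c ℓ * e ℓ))) (∑-coeff-suc-suc k n a₀ a′) ⟩
  sumUpTo k (λ ℓ → c ℓ * e ℓ) + c (suc k) * e (suc k) + - (+ 2 * a₀) * perClosed k n a′
    ≡⟨ cong (λ z → sumUpTo k (λ ℓ → c ℓ * e ℓ) + z + - (+ 2 * a₀) * perClosed k n a′)
            (trans (cong (c (suc k) *_) (esym-vanishes k (suc k) a′ ℕP.≤-refl)) (ℤP.*-zeroʳ (c (suc k)))) ⟩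
  sumUpTo k (λ ℓ → c ℓ * e ℓ) + + 0 + - (+ 2 * a₀) * perClosed k n a′
    ≡⟨ cong (_+ - (+ 2 * a₀) * perClosed k n a′)
            (trans (ℤP.+-identityʳ _) (∑-coeff-suc (ℕP.m≤n⇒m≤1+n k≤n) a′)) ⟩
  (+ suc n - + k) * perClosed k (suc n) a′ + - (+ 2 * a₀) * perClosed k n a′
    ≡⟨ finish ((+ suc n - + k) * perClosed k (suc n) a′) a₀ (perClosed k n a′) ⟩
  (+ suc n - + k) * perClosed k (suc n) a′ - + 2 * a₀ * perClosed k n a′ ∎
  where
  c = coeff (suc n) (suc k)
  a₀ = a zero
  a′ = a ∘ suc
  e = λ ℓ → esym k ℓ a′
  regroup : ∀ x y z → x + (y + z) ≡ (x + z) + y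
  regroup = solve-∀
  finish : ∀ s a₀ t → s + - (+ 2 * a₀) * t ≡ s - + 2 * a₀ * t
  finish = solve-∀

perPoly≡perClosed : ∀ k n → k ≤ n → ∀ a → perPoly k (+ n) a ≡ perClosed k n a
perPoly≡perClosed zero    n       z≤n       a = refl
perPoly≡perClosed (suc k) (suc n) (s≤s k≤n) a = begin
  (+ suc n - + k) * perPoly k (+ suc n) a′ - + 2 * a zero * perPoly k (+ suc n - + 1) a′
    ≡⟨ cong₂ (λ p q → (+ suc n - + k) * p - + 2 * a zero * q)
             (perPoly≡perClosed k (suc n) (ℕP.m≤n⇒m≤1+n k≤n) a′)
             (trans (cong (λ m → perPoly k m a′) (+[1+n]-1≡+n n)) (perPoly≡perClosed k n k≤n a′)) ⟩
  (+ suc n - + k) * perClosed k (suc n) a′ - + 2 * a zero * perClosed k n a′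
    ≡⟨ perClosed-suc k n k≤n a ⟨
  perClosed (suc k) (suc n) a ∎
  where a′ = a ∘ suc

isMinusOne : ℤ → ℤ
isMinusOne x = 𝟙 (x ℤP.≟ -[1+ 0 ])

±1≡1-2*isMinusOne : ∀ {x} → x ≡ + 1 ⊎ x ≡ -[1+ 0 ] → x ≡ + 1 - + 2 * isMinusOne x
±1≡1-2*isMinusOne (inj₁ refl) = refl
±1≡1-2*isMinusOne (inj₂ refl) = refl

rowSum-isMinusOne : ∀ {n} (r : Fin n → ℤ) → ∑[ c < n ] isMinusOne (r c) ≡ + countNeg r
rowSum-isMinusOne {n} r = sym (trans (length-filter (λ c → r c ℤP.≟ -[1+ 0 ]) (allFin n)) (∑ˡ-allFin n _))

lemma1 : (k n : ℕ) → 1 ≤ k → k ≤ n →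
    (ns : Fin k → ℕ) → sumFinℕ k ns ≤ n →
    (B : Fin k → Fin n → ℤ) →
    (∀ i c → B i c ≡ + 1 ⊎ B i c ≡ -[1+ 0 ]) →
    (∀ c i j → B i c ≡ -[1+ 0 ] → B j c ≡ -[1+ 0 ] → i ≡ j) →
    (∀ i → countNeg (B i) ≡ ns i) →
    per B ≡ sumUpTo k (λ ℓ → (-[1+ 1 ] ℤ.^ ℓ) ℤ.* + falling (n ∸ ℓ) (k ∸ ℓ) ℤ.* esym k ℓ (λ i → + ns i))
lemma1 k n _ k≤n ns _ B ±1 disjoint count = begin
  per B                                   ≡⟨ per-cong (λ i c → ±1≡1-2*isMinusOne (±1 i c)) ⟩
  per (λ i c → + 1 - + 2 * N i c)         ≡⟨ per-J-2N k n N N-disjoint k≤n ⟩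
  perPoly k (+ n) (rowSum N)              ≡⟨ perPoly-cong k (+ n) row-sums ⟩
  perPoly k (+ n) (λ i → + ns i)          ≡⟨ perPoly≡perClosed k n k≤n (λ i → + ns i) ⟩
  perClosed k n (λ i → + ns i)            ∎
  where
  N : Fin k → Fin n → ℤ
  N i c = isMinusOne (B i c)
  N-disjoint : ColumnDisjoint N
  N-disjoint c i i′ p q = disjoint c i i′ (𝟙≢0⇒ (B i c ℤP.≟ -[1+ 0 ]) p) (𝟙≢0⇒ (B i′ c ℤP.≟ -[1+ 0 ]) q)
  row-sums : ∀ i → rowSum N i ≡ + ns i
  row-sums i = trans (rowSum-isMinusOne (B i)) (cong +_ (count i))
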